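{- (i) There are uncountably many monotone increasing integer sequences which are MC-finite, and uncountably many monotone increasing integer sequences which are not MC-finite. (ii) Almost all bounded integer sequences are not MC-finite: for every integer $b\ge 2$, the set of sequences $s:\mathbb{N}\to\{0,\ldots,b-1\}$ that are MC-finite has Lebesgue measure $0$, where such sequences are identified with the real numbers in $[0,1]$ whose base-$b$ expansions they are.
   Context: A sequence of integers $s(n)$ is MC-finite if for every $m\in\mathbb{N}^+$ there are $p_m,q_m\in\mathbb{N}^+$ and $c_{i,m}\in\mathbb{Z}$ such that $s(n+p_m)\equiv\sum_{i=0}^{p_m-1}c_{i,m}s(n+i)\pmod m$ for all $n\ge q_m$; equivalently, $s(n)\bmod m$ is ultimately periodic for every $m$. -}

module Defs where

open import Data.Nat as ℕ using (ℕ; zero; suc; _≤_; s≤s; z≤n; NonZero; >-nonZero)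
open import Data.Nat.Properties using (≤-trans; m^n≢0)
open import Data.Integer as ℤ using (ℤ; +_)
open import Data.Integer.Divisibility using (_∣_)
open import Data.Rational as ℚ using (ℚ; 0ℚ)
open import Data.Fin using (Fin; toℕ)
open import Data.Bool using (Bool)
open import Data.List using (List; map; upTo; length)
open import Data.Product using (Σ; ∃; _×_; Σ-syntax; ∃-syntax)
open import Relation.Binary.PropositionalEquality using (_≡_)

sumℤ : ℕ → (ℕ → ℤ) → ℤ
sumℤ zero    f = + 0
sumℤ (suc n) f = sumℤ n f ℤ.+ f n

sumℚ : ℕ → (ℕ → ℚ) → ℚ
sumℚ zero    f = 0ℚ
sumℚ (suc n) f = sumℚ n f ℚ.+ f n

_≡_[mod_] : ℤ → ℤ → ℕ → Set
a ≡ b [mod m ] = (+ m) ∣ (a ℤ.- b)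

MCFinite : (ℕ → ℤ) → Set
MCFinite s =
  (m : ℕ) → 1 ≤ m →
  Σ[ p ∈ ℕ ] Σ[ q ∈ ℕ ] Σ[ c ∈ (ℕ → ℤ) ]
    (1 ≤ p) × (1 ≤ q) ×
    ((n : ℕ) → q ≤ n →
      s (n ℕ.+ p) ≡ sumℤ p (λ i → c i ℤ.* s (n ℕ.+ i)) [mod m ])

MonotoneIncreasing : (ℕ → ℤ) → Set
MonotoneIncreasing s = (n : ℕ) → s n ℤ.≤ s (suc n)

-- "Uncountably many sequences satisfy P": Cantor space 2^ℕ embeds
-- (injectively, w.r.t. pointwise equality) into the sequences satisfying P.
UncountablyMany : ((ℕ → ℤ) → Set) → Set
UncountablyMany P =
  Σ[ f ∈ ((ℕ → Bool) → (ℕ → ℤ)) ]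
    ((α : ℕ → Bool) → P (f α)) ×
    ((α β : ℕ → Bool) → ((n : ℕ) → f α n ≡ f β n) → (n : ℕ) → α n ≡ β n)

cylWeight : (b : ℕ) → 2 ≤ b → ℕ → ℚ
cylWeight b hb L =
  let instance _ : NonZero b
               _ = >-nonZero (≤-trans (s≤s z≤n) hb)
  in ℚ._/_ (+ 1) (b ℕ.^ L) ⦃ m^n≢0 b L ⦄

prefix : {b : ℕ} → (ℕ → Fin b) → ℕ → List (Fin b)
prefix s L = map s (upTo L)

-- A set of base-b digit sequences (identified with reals in [0,1] via
-- base-b expansion) has Lebesgue measure 0: for every rational ε > 0 it is
-- covered by countably many b-adic intervals (cylinders [w] = sequences with
-- prefix w, of length b^(-|w|)) whose total length is ≤ ε.
LebesgueNull : (b : ℕ) → 2 ≤ b → ((ℕ → Fin b) → Set) → Set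
LebesgueNull b hb A =
  (ε : ℚ) → 0ℚ ℚ.< ε →
  Σ[ C ∈ (ℕ → List (Fin b)) ]
    ((s : ℕ → Fin b) → A s → ∃[ j ] prefix s (length (C j)) ≡ C j) ×
    ((N : ℕ) → sumℚ N (λ j → cylWeight b hb (length (C j))) ℚ.≤ ε)

digitsℤ : {b : ℕ} → (ℕ → Fin b) → ℕ → ℤ
digitsℤ s n = + toℕ (s n)

-- (i) For a bit sequence α, the sums of k! over the k < n with α k = true are monotone, determine
-- α, and are MC-finite: m ∣ k! once k ≥ m, so modulo m they are eventually constant. The numbers
-- 4n + 2 α(n) + [n is a power of 2] are monotone and determine α, but modulo 2 they are the
-- indicator of the powers of 2, whose gaps outgrow every recurrence: a recurrence of order p
-- would make the power of 2 following p even terms even.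
-- (ii) Modulo b an MC-finite digit sequence is determined by the order p and offset q of its
-- recurrence, the coefficients modulo b and its first q + p digits. So these sequences can be
-- enumerated, and covering the j-th one by its cylinder of length j + 1 + K costs at most
-- Σ_j 2^-(j+1+K) = 2^-K ≤ ε for K the denominator of ε.

module Submission where

open import Data.Bool using (Bool; true; false)
open import Data.Fin using (Fin; toℕ; fromℕ<)
import Data.Fin.Properties as Finₚ
open import Data.Integer as ℤ using (ℤ; +_; _-_)
open import Data.Integer.Divisibility using () renaming (_∣_ to _∣ᵤ_)
open import Data.Integer.DivMod using (_%ℕ_; _/ℕ_; n%ℕd<d; a≡a%ℕn+[a/ℕn]*n)
open import Data.Integer.Divisibility.Signed as ℤ∣ using (∣ᵤ⇒∣; ∣⇒∣ᵤ) renaming (_∣_ to _∣ℤ_)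
import Data.Integer.GCD as ℤGCD
import Data.Integer.Properties as ℤₚ
open import Data.Integer.Tactic.RingSolver using (solve-∀)
open import Data.List using (List; upTo; length)
import Data.List.Properties as Listₚ
open import Data.Nat as ℕ using (ℕ; zero; suc; _≤_; _<_; _+_; _∸_; _^_; _!; z≤n; s≤s; NonZero)
open import Data.Nat.DivMod using (_mod_; m<n⇒m%n≡m)
import Data.Nat.Divisibility as ℕ∣
import Data.Nat.Properties as ℕₚ
import Data.Nat.Tactic.RingSolver as ℕRing
open import Data.Product using (_×_; _,_; proj₁; proj₂; ∃-syntax)
open import Data.Rational as ℚ using (ℚ; 0ℚ; mkℚ; ↥_; ↧_; ↧ₙ_; toℚᵘ)
import Data.Rational.Properties as ℚₚ
import Data.Rational.Unnormalised as ℚᵘ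
import Data.Rational.Unnormalised.Properties as ℚᵘₚ
open import Function using (_∘_)
open import Relation.Binary.PropositionalEquality
open import Relation.Nullary using (¬_; Dec; yes; no; does; contradiction)
open import Relation.Nullary.Decidable using (map′; dec-true; dec-false)

open import Algebra.Properties.AbelianGroup ℤₚ.+-0-abelianGroup using (xyx⁻¹≈y; ∙-cancelˡ)

open import Defs

n<2^n : ∀ n → n < 2 ^ n
n<2^n zero    = s≤s z≤n
n<2^n (suc n) = ℕₚ.<-≤-trans (s≤s (n<2^n n))
  (ℕₚ.m<m+n (2 ^ n) (ℕₚ.<-≤-trans (ℕₚ.m^n>0 2 n) (ℕₚ.m≤m+n (2 ^ n) 0)))

m∣n! : ∀ {m n} → 1 ≤ m → m ≤ n → m ℕ∣.∣ n !
m∣n! {suc k} _ m≤n = ℕ∣.∣-trans (ℕ∣.m∣m*n (k !)) (ℕ∣.m≤n⇒m!∣n! m≤n)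

bit : Bool → ℕ
bit false = 0
bit true  = 1

bit≤1 : ∀ a → bit a ≤ 1
bit≤1 false = z≤n
bit≤1 true  = s≤s z≤n

bit-injective : ∀ {a a′} → bit a ≡ bit a′ → a ≡ a′
bit-injective {false} {false} _ = refl
bit-injective {true}  {true}  _ = refl

-- Signed-divisibility form of _≡_[mod_], wrapped in a record so that x and y are inferable.
infix 4 _≡_⟨mod_⟩
record _≡_⟨mod_⟩ (x y : ℤ) (m : ℕ) : Set where
  constructor ⟨mod⟩
  field divides-difference : + m ∣ℤ x - y

module _ {m : ℕ} where

  [mod]⇒⟨mod⟩ : ∀ {x y} → x ≡ y [mod m ] → x ≡ y ⟨mod m ⟩
  [mod]⇒⟨mod⟩ = ⟨mod⟩ ∘ ∣ᵤ⇒∣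

  mod-refl : ∀ {x} → x ≡ x ⟨mod m ⟩
  mod-refl {x} = ⟨mod⟩ (ℤ∣.divides (+ 0) (ℤₚ.+-inverseʳ x))

  mod-trans : ∀ {x y z} → x ≡ y ⟨mod m ⟩ → y ≡ z ⟨mod m ⟩ → x ≡ z ⟨mod m ⟩
  mod-trans {x} {y} {z} (⟨mod⟩ m∣x-y) (⟨mod⟩ m∣y-z) =
    ⟨mod⟩ (subst (+ m ∣ℤ_) (ℤₚ.+-minus-telescope x y z) (ℤ∣.∣m∣n⇒∣m+n m∣x-y m∣y-z))

  mod-+ : ∀ {x y x′ y′} → x ≡ y ⟨mod m ⟩ → x′ ≡ y′ ⟨mod m ⟩ → x ℤ.+ x′ ≡ y ℤ.+ y′ ⟨mod m ⟩
  mod-+ {x} {y} {x′} {y′} (⟨mod⟩ m∣x-y) (⟨mod⟩ m∣x′-y′) =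
    ⟨mod⟩ (subst (+ m ∣ℤ_) (regroup x y x′ y′) (ℤ∣.∣m∣n⇒∣m+n m∣x-y m∣x′-y′))
    where
    regroup : ∀ x y x′ y′ → (x - y) ℤ.+ (x′ - y′) ≡ (x ℤ.+ x′) - (y ℤ.+ y′)
    regroup = solve-∀

  mod-*ʳ : ∀ {x y} z → x ≡ y ⟨mod m ⟩ → x ℤ.* z ≡ y ℤ.* z ⟨mod m ⟩
  mod-*ʳ {x} {y} z (⟨mod⟩ m∣x-y) =
    ⟨mod⟩ (subst (+ m ∣ℤ_) (distrib x y z) (ℤ∣.∣m⇒∣m*n z m∣x-y))
    where
    distrib : ∀ x y z → (x - y) ℤ.* z ≡ x ℤ.* z - y ℤ.* z
    distrib = solve-∀

  mod-sumℤ : ∀ p {f g} → (∀ i → i < p → f i ≡ g i ⟨mod m ⟩) → sumℤ p f ≡ sumℤ p g ⟨mod m ⟩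
  mod-sumℤ zero    f≡g = mod-refl
  mod-sumℤ (suc p) f≡g = mod-+ (mod-sumℤ p (λ i i<p → f≡g i (ℕₚ.m<n⇒m<1+n i<p))) (f≡g p ℕₚ.≤-refl)

module _ {b : ℕ} .{{_ : NonZero b}} where

  mod-%ℕ : ∀ x → x ≡ + (x %ℕ b) ⟨mod b ⟩
  mod-%ℕ x = ⟨mod⟩ (ℤ∣.divides (x /ℕ b) (begin
    x - + (x %ℕ b)                                 ≡⟨ cong (_- + (x %ℕ b)) (a≡a%ℕn+[a/ℕn]*n x b) ⟩
    (+ (x %ℕ b) ℤ.+ (x /ℕ b) ℤ.* + b) - + (x %ℕ b) ≡⟨ xyx⁻¹≈y (+ (x %ℕ b)) ((x /ℕ b) ℤ.* + b) ⟩
    (x /ℕ b) ℤ.* + b                               ∎))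
    where open ≡-Reasoning

  mod-residue-unique : ∀ {v w} → v < b → w < b → + v ≡ + w ⟨mod b ⟩ → v ≡ w
  mod-residue-unique {v} {w} v<b w<b (⟨mod⟩ b∣v-w) =
    ℤₚ.+-injective (ℤₚ.i-j≡0⇒i≡j (+ v) (+ w) (ℤₚ.∣i∣≡0⇒i≡0 distance≡0))
    where
    distance<b : ℤ.∣ + v - + w ∣ < b
    distance<b = subst (_< b) (sym (cong ℤ.∣_∣ (ℤₚ.m-n≡m⊖n v w)))
                   (ℕₚ.≤-<-trans (ℤₚ.∣m⊝n∣≤m⊔n v w) (ℕₚ.⊔-lub v<b w<b))
    distance≡0 : ℤ.∣ + v - + w ∣ ≡ 0
    distance≡0 = trans (sym (m<n⇒m%n≡m distance<b)) (ℕ∣.n∣m⇒m%n≡0 _ b (∣⇒∣ᵤ b∣v-w))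

sumℤ-cong : ∀ p {f g} → (∀ i → i < p → f i ≡ g i) → sumℤ p f ≡ sumℤ p g
sumℤ-cong zero    f≡g = refl
sumℤ-cong (suc p) f≡g = cong₂ ℤ._+_ (sumℤ-cong p (λ i i<p → f≡g i (ℕₚ.m<n⇒m<1+n i<p))) (f≡g p ℕₚ.≤-refl)

∣-sumℤ : ∀ {k} p {f} → (∀ i → i < p → k ∣ℤ f i) → k ∣ℤ sumℤ p f
∣-sumℤ {k} zero k∣f = ℤ∣.divides (+ 0) (sym (ℤₚ.*-zeroˡ k))
∣-sumℤ (suc p) k∣f = ℤ∣.∣m∣n⇒∣m+n (∣-sumℤ p (λ i i<p → k∣f i (ℕₚ.m<n⇒m<1+n i<p))) (k∣f p ℕₚ.≤-refl)

sumℤ-injective : ∀ {f g} → (∀ n → sumℤ n f ≡ sumℤ n g) → ∀ n → f n ≡ g n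
sumℤ-injective {f} {g} sums≡ n =
  ∙-cancelˡ (sumℤ n f) (f n) (g n) (trans (sums≡ (suc n)) (cong (ℤ._+ g n) (sym (sums≡ n))))

sumℚ-mono-≤ : ∀ N {f g} → (∀ j → f j ℚ.≤ g j) → sumℚ N f ℚ.≤ sumℚ N g
sumℚ-mono-≤ zero    f≤g = ℚₚ.≤-refl
sumℚ-mono-≤ (suc N) f≤g = ℚₚ.+-mono-≤ (sumℚ-mono-≤ N f≤g) (f≤g N)

eventually-constant-mod⇒MCFinite : ∀ s →
  ((m : ℕ) → 1 ≤ m → ∃[ q ] 1 ≤ q × ((n : ℕ) → q ≤ n → s (suc n) ≡ s n [mod m ])) →
  MCFinite s
eventually-constant-mod⇒MCFinite s constant m 1≤m with constant m 1≤m
... | q , 1≤q , s′≡s = 1 , q , (λ _ → + 1) , ℕₚ.≤-refl , 1≤q , λ n q≤n →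
  subst₂ (λ x y → x ≡ y [mod m ]) (cong s (ℕₚ.+-comm 1 n)) (sym (sum≡ n)) (s′≡s n q≤n)
  where
  sum≡ : ∀ n → sumℤ 1 (λ i → + 1 ℤ.* s (n + i)) ≡ s n
  sum≡ n = trans (ℤₚ.+-identityˡ _) (trans (ℤₚ.*-identityˡ _) (cong s (ℕₚ.+-identityʳ n)))

-- The recurrence modulo m forces m ∣ s (N + p) as soon as m divides the p preceding terms.
divisibility-gaps⇒¬MCFinite : ∀ s m → 1 ≤ m →
  (∀ p q → ∃[ N ] q ≤ N × (∀ i → i < p → + m ∣ℤ s (N + i)) × ¬ (+ m ∣ℤ s (N + p))) →
  ¬ MCFinite s
divisibility-gaps⇒¬MCFinite s m 1≤m gaps mc with mc m 1≤m
... | p , q , c , _ , _ , rec with gaps p q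
... | N , q≤N , m∣earlier , m∤last =
  m∤last (ℤ∣.∣m+n∣n⇒∣m (∣ᵤ⇒∣ (rec N q≤N)) (ℤ∣.∣m⇒∣-m m∣sum))
  where
  m∣sum : + m ∣ℤ sumℤ p (λ i → c i ℤ.* s (N + i))
  m∣sum = ∣-sumℤ p λ i i<p → ℤ∣.∣n⇒∣m*n (c i) (m∣earlier i i<p)

-- Monotone MC-finite sequences

factorialSums : (ℕ → Bool) → ℕ → ℤ
factorialSums α n = sumℤ n (λ k → + (bit (α k) ℕ.* k !))

factorialSums-monotone : ∀ α → MonotoneIncreasing (factorialSums α)
factorialSums-monotone α n = ℤₚ.i≤i+j (factorialSums α n) (+ (bit (α n) ℕ.* n !))

factorialSums-MCFinite : ∀ α → MCFinite (factorialSums α)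
factorialSums-MCFinite α = eventually-constant-mod⇒MCFinite (factorialSums α) λ m 1≤m →
  m , 1≤m , λ n m≤n →
    subst (+ m ∣ᵤ_) (sym (xyx⁻¹≈y (factorialSums α n) _)) (ℕ∣.∣n⇒∣m*n (bit (α n)) (m∣n! 1≤m m≤n))

factorialSums-injective : ∀ α β → (∀ n → factorialSums α n ≡ factorialSums β n) → ∀ n → α n ≡ β n
factorialSums-injective α β sums≡ n =
  bit-injective (ℕₚ.*-cancelʳ-≡ _ _ (n !) {{n ℕₚ.!≢0}} (ℤₚ.+-injective (sumℤ-injective sums≡ n)))

-- Monotone sequences that are not MC-finite

IsPowerOf2 : ℕ → Set
IsPowerOf2 n = ∃[ k ] 2 ^ k ≡ n

isPowerOf2? : ∀ n → Dec (IsPowerOf2 n)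
isPowerOf2? n = map′ fromBounded toBounded (Finₚ.any? λ (k : Fin (suc n)) → 2 ^ toℕ k ℕ.≟ n)
  where
  fromBounded : ∃[ k ] 2 ^ toℕ {suc n} k ≡ n → IsPowerOf2 n
  fromBounded (k , 2^k≡n) = toℕ k , 2^k≡n
  toBounded : IsPowerOf2 n → ∃[ k ] 2 ^ toℕ {suc n} k ≡ n
  toBounded (k , 2^k≡n) = fromℕ< k<1+n , trans (cong (2 ^_) (Finₚ.toℕ-fromℕ< k<1+n)) 2^k≡n
    where
    k<1+n : k < suc n
    k<1+n = s≤s (ℕₚ.<⇒≤ (subst (k <_) 2^k≡n (n<2^n k)))

¬IsPowerOf2-between : ∀ K {n} → 2 ^ K < n → n < 2 ^ suc K → ¬ IsPowerOf2 n
¬IsPowerOf2-between K lo hi (k , refl) with k ℕ.≤? K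
... | yes k≤K = ℕₚ.<⇒≱ lo (ℕₚ.^-monoʳ-≤ 2 k≤K)
... | no  k≰K = ℕₚ.<⇒≱ hi (ℕₚ.^-monoʳ-≤ 2 (ℕₚ.≰⇒> k≰K))

-- The p numbers before 2 ^ (1 + p + q) lie strictly between two consecutive powers of 2.
powersOf2-gaps : ∀ p q → ∃[ N ] q ≤ N × (∀ i → i < p → ¬ IsPowerOf2 (N + i)) × IsPowerOf2 (N + p)
powersOf2-gaps p q =
  N , q≤N , (λ i i<p → ¬IsPowerOf2-between K (2^K<N+i i) (N+i<2^1+K i<p)) , (suc K , sym N+p≡2^1+K)
  where
  K N : ℕ
  K = p + q
  N = 2 ^ suc K ∸ p
  1+2^K+p≤2^1+K : suc (2 ^ K) + p ≤ 2 ^ suc K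
  1+2^K+p≤2^1+K =
    ℕₚ.+-monoʳ-< (2 ^ K) (ℕₚ.<-≤-trans (ℕₚ.≤-<-trans (ℕₚ.m≤m+n p q) (n<2^n K)) (ℕₚ.m≤m+n (2 ^ K) 0))
  2^K<N : 2 ^ K < N
  2^K<N = ℕₚ.m+n≤o⇒m≤o∸n (suc (2 ^ K)) 1+2^K+p≤2^1+K
  N+p≡2^1+K : N + p ≡ 2 ^ suc K
  N+p≡2^1+K = ℕₚ.m∸n+n≡m (ℕₚ.m+n≤o⇒n≤o (suc (2 ^ K)) 1+2^K+p≤2^1+K)
  2^K<N+i : ∀ i → 2 ^ K < N + i
  2^K<N+i i = ℕₚ.<-≤-trans 2^K<N (ℕₚ.m≤m+n N i)
  N+i<2^1+K : ∀ {i} → i < p → N + i < 2 ^ suc K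
  N+i<2^1+K {i} i<p = subst (N + i <_) N+p≡2^1+K (ℕₚ.+-monoʳ-< N i<p)
  q≤N : q ≤ N
  q≤N = ℕₚ.≤-trans (ℕₚ.m≤n+m q p) (ℕₚ.<⇒≤ (ℕₚ.<-trans (n<2^n K) 2^K<N))

oddAtPowersOf2 : (ℕ → Bool) → ℕ → ℤ
oddAtPowersOf2 α n = + (bit (does (isPowerOf2? n)) + 2 ℕ.* (bit (α n) + 2 ℕ.* n))

oddAtPowersOf2-monotone : ∀ α → MonotoneIncreasing (oddAtPowersOf2 α)
oddAtPowersOf2-monotone α n = ℤ.+≤+ (begin
  bit (does (isPowerOf2? n)) + 2 ℕ.* (bit (α n) + 2 ℕ.* n)
    ≤⟨ ℕₚ.+-mono-≤ (bit≤1 (does (isPowerOf2? n)))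
                   (ℕₚ.*-monoʳ-≤ 2 (ℕₚ.+-monoˡ-≤ (2 ℕ.* n) (bit≤1 (α n)))) ⟩
  1 + 2 ℕ.* (1 + 2 ℕ.* n)
    ≤⟨ ℕₚ.n≤1+n _ ⟩
  2 + 2 ℕ.* (1 + 2 ℕ.* n)
    ≡⟨ reshape n ⟩
  2 ℕ.* (2 ℕ.* suc n)
    ≤⟨ ℕₚ.*-monoʳ-≤ 2 (ℕₚ.m≤n+m (2 ℕ.* suc n) (bit (α (suc n)))) ⟩
  2 ℕ.* (bit (α (suc n)) + 2 ℕ.* suc n)
    ≤⟨ ℕₚ.m≤n+m _ (bit (does (isPowerOf2? (suc n)))) ⟩
  bit (does (isPowerOf2? (suc n))) + 2 ℕ.* (bit (α (suc n)) + 2 ℕ.* suc n) ∎)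
  where
  open ℕₚ.≤-Reasoning
  reshape : ∀ n → 2 + 2 ℕ.* (1 + 2 ℕ.* n) ≡ 2 ℕ.* (2 ℕ.* suc n)
  reshape = ℕRing.solve-∀

oddAtPowersOf2-injective : ∀ α β → (∀ n → oddAtPowersOf2 α n ≡ oddAtPowersOf2 β n) → ∀ n → α n ≡ β n
oddAtPowersOf2-injective α β values≡ n = bit-injective
  (ℕₚ.+-cancelʳ-≡ (2 ℕ.* n) _ _ (ℕₚ.*-cancelˡ-≡ _ _ 2
    (ℕₚ.+-cancelˡ-≡ (bit (does (isPowerOf2? n))) _ _ (ℤₚ.+-injective (values≡ n)))))

oddAtPowersOf2-even : ∀ α {n} → ¬ IsPowerOf2 n → + 2 ∣ℤ oddAtPowersOf2 α n
oddAtPowersOf2-even α {n} ¬pow rewrite dec-false (isPowerOf2? n) ¬pow =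
  ∣ᵤ⇒∣ (ℕ∣.m∣m*n (bit (α n) + 2 ℕ.* n))

oddAtPowersOf2-odd : ∀ α {n} → IsPowerOf2 n → ¬ (+ 2 ∣ℤ oddAtPowersOf2 α n)
oddAtPowersOf2-odd α {n} pow rewrite dec-true (isPowerOf2? n) pow = λ 2∣1+2w →
  contradiction (ℕ∣.∣1⇒≡1 (ℕ∣.∣m+n∣m⇒∣n (subst (2 ℕ∣.∣_) (ℕₚ.+-comm 1 (2 ℕ.* w)) (∣⇒∣ᵤ 2∣1+2w))
                                         (ℕ∣.m∣m*n w))) λ ()
  where
  w : ℕ
  w = bit (α n) + 2 ℕ.* n

oddAtPowersOf2-¬MCFinite : ∀ α → ¬ MCFinite (oddAtPowersOf2 α)
oddAtPowersOf2-¬MCFinite α = divisibility-gaps⇒¬MCFinite (oddAtPowersOf2 α) 2 (s≤s z≤n) λ p q →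
  let N , q≤N , earlier , last = powersOf2-gaps p q
  in N , q≤N , (λ i i<p → oddAtPowersOf2-even α (earlier i i<p)) , oddAtPowersOf2-odd α last

1/ℕ : (n : ℕ) .{{_ : NonZero n}} → ℚ
1/ℕ n = + 1 ℚ./ n

gcd[1,n]-cancel : ∀ n {x y} → x ℤ.* ℤGCD.gcd (+ 1) (+ n) ≡ y → x ≡ y
gcd[1,n]-cancel n {x} eq =
  trans (sym (ℤₚ.*-identityʳ x)) (trans (cong (x ℤ.*_) (sym (ℤGCD.gcd-zeroˡ (+ n)))) eq)

↥-1/ℕ : ∀ n .{{_ : NonZero n}} → ↥ 1/ℕ n ≡ + 1
↥-1/ℕ n = gcd[1,n]-cancel n (ℚₚ.↥-/ (+ 1) n)

↧-1/ℕ : ∀ n .{{_ : NonZero n}} → ↧ 1/ℕ n ≡ + n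
↧-1/ℕ n = gcd[1,n]-cancel n (ℚₚ.↧-/ (+ 1) n)

1/ℕ-antimono-≤ : ∀ {m n} .{{_ : NonZero m}} .{{_ : NonZero n}} → m ≤ n → 1/ℕ n ℚ.≤ 1/ℕ m
1/ℕ-antimono-≤ {m} {n} m≤n = ℚ.*≤* (subst₂ ℤ._≤_
  (cong₂ ℤ._*_ (sym (↥-1/ℕ n)) (sym (↧-1/ℕ m))) (cong₂ ℤ._*_ (sym (↥-1/ℕ m)) (sym (↧-1/ℕ n)))
  (ℤₚ.*-monoˡ-≤-nonNeg (+ 1) (ℤ.+≤+ m≤n)))

1/ℕ-↧-≤ : ∀ ε → 0ℚ ℚ.< ε → 1/ℕ (↧ₙ ε) ℚ.≤ ε
1/ℕ-↧-≤ (mkℚ (+ suc a) d _) _ = ℚ.*≤* (subst₂ ℤ._≤_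
  (cong (ℤ._* + suc d) (sym (↥-1/ℕ (suc d)))) (cong (+ suc a ℤ.*_) (sym (↧-1/ℕ (suc d))))
  (ℤₚ.*-monoʳ-≤-nonNeg (+ suc d) (ℤ.+≤+ (s≤s (z≤n {a})))))
1/ℕ-↧-≤ (mkℚ (+ zero)   _ _) (ℚ.*<* (ℤ.+<+ ()))
1/ℕ-↧-≤ (mkℚ ℤ.-[1+ _ ] _ _) (ℚ.*<* ())

1/ℕᵘ : (n : ℕ) .{{_ : NonZero n}} → ℚᵘ.ℚᵘ
1/ℕᵘ n = + 1 ℚᵘ./ n

toℚᵘ-1/ℕ : ∀ n .{{_ : NonZero n}} → toℚᵘ (1/ℕ n) ℚᵘ.≃ 1/ℕᵘ n
toℚᵘ-1/ℕ n = ℚᵘ.*≡* (trans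
  (cong₂ ℤ._*_ (trans (ℚₚ.↥ᵘ-toℚᵘ (1/ℕ n)) (↥-1/ℕ n)) (ℚᵘₚ.↧[n/d]≡d (+ 1) n))
  (sym (cong₂ ℤ._*_ (ℚᵘₚ.↥[n/d]≡n (+ 1) n) (trans (ℚₚ.↧ᵘ-toℚᵘ (1/ℕ n)) (↧-1/ℕ n)))))

1/ℕᵘ-half : ∀ n .{{_ : NonZero n}} →
            1/ℕᵘ (2 ℕ.* n) {{ℕₚ.m*n≢0 2 n}} ℚᵘ.+ 1/ℕᵘ (2 ℕ.* n) {{ℕₚ.m*n≢0 2 n}} ℚᵘ.≃ 1/ℕᵘ n
-- With n = suc _, both 2 * n and the sum's denominator reduce to suc _, so ℚᵘ._/_ and ℚᵘ._+_ compute.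
1/ℕᵘ-half n@(suc _) = ℚᵘ.*≡* cross-multiplied
  where
  double : ∀ x →
    (+ 1 ℤ.* (+ 2 ℤ.* x) ℤ.+ + 1 ℤ.* (+ 2 ℤ.* x)) ℤ.* x ≡ + 1 ℤ.* ((+ 2 ℤ.* x) ℤ.* (+ 2 ℤ.* x))
  double = solve-∀
  cross-multiplied :
    (+ 1 ℤ.* + (2 ℕ.* n) ℤ.+ + 1 ℤ.* + (2 ℕ.* n)) ℤ.* + n ≡ + 1 ℤ.* + (2 ℕ.* n ℕ.* (2 ℕ.* n))
  cross-multiplied rewrite ℤₚ.pos-* (2 ℕ.* n) (2 ℕ.* n) | ℤₚ.pos-* 2 n = double (+ n)

-- ℚ._+_ normalises through a gcd, so the identity is checked on unnormalised fractions.
1/ℕ-half : ∀ n .{{_ : NonZero n}} →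
           1/ℕ (2 ℕ.* n) {{ℕₚ.m*n≢0 2 n}} ℚ.+ 1/ℕ (2 ℕ.* n) {{ℕₚ.m*n≢0 2 n}} ≡ 1/ℕ n
1/ℕ-half n = ℚₚ.toℚᵘ-injective (begin
  toℚᵘ (h ℚ.+ h)          ≈⟨ ℚₚ.toℚᵘ-homo-+ h h ⟩
  toℚᵘ h ℚᵘ.+ toℚᵘ h      ≈⟨ ℚᵘₚ.+-cong (toℚᵘ-1/ℕ (2 ℕ.* n)) (toℚᵘ-1/ℕ (2 ℕ.* n)) ⟩
  1/ℕᵘ (2 ℕ.* n) ℚᵘ.+ 1/ℕᵘ (2 ℕ.* n) ≈⟨ 1/ℕᵘ-half n ⟩
  1/ℕᵘ n                  ≈⟨ toℚᵘ-1/ℕ n ⟨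
  toℚᵘ (1/ℕ n)            ∎)
  where
  open ℚᵘₚ.≃-Reasoning
  instance _ = ℕₚ.m*n≢0 2 n
  h : ℚ
  h = 1/ℕ (2 ℕ.* n)

p≤p+q : ∀ p {q} → ℚ.NonNegative q → p ℚ.≤ p ℚ.+ q
p≤p+q p {q} q≥0 =
  subst (ℚ._≤ p ℚ.+ q) (ℚₚ.+-identityʳ p) (ℚₚ.+-mono-≤ (ℚₚ.≤-refl {p}) (ℚₚ.nonNegative⁻¹ q {{q≥0}}))

½^ : ℕ → ℚ
½^ n = 1/ℕ (2 ^ n) {{ℕₚ.m^n≢0 2 n}}

½^-half : ∀ n → ½^ (suc n) ℚ.+ ½^ (suc n) ≡ ½^ n
½^-half n = 1/ℕ-half (2 ^ n) {{ℕₚ.m^n≢0 2 n}}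

½^-nonNeg : ∀ n → ℚ.NonNegative (½^ n)
½^-nonNeg n = ℚₚ.normalize-nonNeg 1 (2 ^ n) {{ℕₚ.m^n≢0 2 n}}

½^-≤-1/ℕ : ∀ n .{{n≢0 : NonZero n}} → ½^ n ℚ.≤ 1/ℕ n
½^-≤-1/ℕ n {{n≢0}} = 1/ℕ-antimono-≤ {{n≢0}} {{ℕₚ.m^n≢0 2 n}} (ℕₚ.<⇒≤ (n<2^n n))

geometric-sum : ∀ K N → sumℚ N (λ j → ½^ (suc j + K)) ℚ.+ ½^ (N + K) ≡ ½^ K
geometric-sum K zero    = ℚₚ.+-identityˡ (½^ K)
geometric-sum K (suc N) = begin
  (S ℚ.+ ½^ (suc N + K)) ℚ.+ ½^ (suc N + K) ≡⟨ ℚₚ.+-assoc S _ _ ⟩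
  S ℚ.+ (½^ (suc N + K) ℚ.+ ½^ (suc N + K)) ≡⟨ cong (S ℚ.+_) (½^-half (N + K)) ⟩
  S ℚ.+ ½^ (N + K)                          ≡⟨ geometric-sum K N ⟩
  ½^ K                                      ∎
  where
  open ≡-Reasoning
  S : ℚ
  S = sumℚ N (λ j → ½^ (suc j + K))

cylWeights-≤ : ∀ b (hb : 2 ≤ b) ε → 0ℚ ℚ.< ε → (ℓ : ℕ → ℕ) → (∀ j → ℓ j ≡ suc j + ↧ₙ ε) →
               ∀ N → sumℚ N (λ j → cylWeight b hb (ℓ j)) ℚ.≤ ε
cylWeights-≤ b hb ε ε>0 ℓ ℓ≡ N = begin
  sumℚ N (λ j → cylWeight b hb (ℓ j))           ≤⟨ sumℚ-mono-≤ N cylWeight≤½^ ⟩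
  sumℚ N (λ j → ½^ (suc j + K))                ≤⟨ p≤p+q _ (½^-nonNeg (N + K)) ⟩
  sumℚ N (λ j → ½^ (suc j + K)) ℚ.+ ½^ (N + K) ≡⟨ geometric-sum K N ⟩
  ½^ K                                         ≤⟨ ½^-≤-1/ℕ K ⟩
  1/ℕ K                                        ≤⟨ 1/ℕ-↧-≤ ε ε>0 ⟩
  ε                                            ∎
  where
  open ℚₚ.≤-Reasoning
  K : ℕ
  K = ↧ₙ ε
  instance _ = ℕ.>-nonZero (ℕₚ.≤-trans (s≤s z≤n) hb)
  cylWeight≤½^ : ∀ j → cylWeight b hb (ℓ j) ℚ.≤ ½^ (suc j + K)
  cylWeight≤½^ j rewrite ℓ≡ j =
    1/ℕ-antimono-≤ {{ℕₚ.m^n≢0 2 (suc j + K)}} {{ℕₚ.m^n≢0 b (suc j + K)}} (ℕₚ.^-monoˡ-≤ (suc j + K) hb)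

-- Countable sets of digit sequences are null

length-prefix : ∀ {b} (s : ℕ → Fin b) L → length (prefix s L) ≡ L
length-prefix s L = trans (Listₚ.length-map s (upTo L)) (Listₚ.length-upTo L)

countable⇒LebesgueNull : ∀ b (hb : 2 ≤ b) {A : (ℕ → Fin b) → Set} (g : ℕ → ℕ → Fin b) →
                         (∀ s → A s → ∃[ j ] s ≗ g j) → LebesgueNull b hb A
countable⇒LebesgueNull b hb {A} g enumerates ε ε>0 = C , covers , cylWeights-≤ b hb ε ε>0 (length ∘ C) ℓ≡
  where
  C : ℕ → List (Fin b)
  C j = prefix (g j) (suc j + ↧ₙ ε)
  ℓ≡ : ∀ j → length (C j) ≡ suc j + ↧ₙ ε
  ℓ≡ j = length-prefix (g j) (suc j + ↧ₙ ε)
  covers : ∀ s → A s → ∃[ j ] prefix s (length (C j)) ≡ C j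
  covers s As with enumerates s As
  ... | j , s≗gj = j , trans (cong (prefix s) (ℓ≡ j)) (Listₚ.map-cong s≗gj (upTo (suc j + ↧ₙ ε)))

-- Cantor's enumeration of ℕ × ℕ, walking down each antidiagonal a + c = const.
next : ℕ × ℕ → ℕ × ℕ
next (a , zero)  = zero , suc a
next (a , suc c) = suc a , c

unpair : ℕ → ℕ × ℕ
unpair zero    = 0 , 0
unpair (suc j) = next (unpair j)

unpair-+ : ∀ k {j a c} → unpair j ≡ (a , k + c) → unpair (k + j) ≡ (k + a , c)
unpair-+ zero    eq = eq
unpair-+ (suc k) {j} {a} {c} eq =
  subst₂ (λ i a′ → unpair i ≡ (a′ , c)) (ℕₚ.+-suc k j) (ℕₚ.+-suc k a) (unpair-+ k (cong next eq))

unpair-antidiagonal : ∀ d → ∃[ j ] unpair j ≡ (0 , d)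
unpair-antidiagonal zero    = 0 , refl
unpair-antidiagonal (suc d) with unpair-antidiagonal d
... | j , eq = suc (d + j) , cong next (subst₂ (λ a c → unpair (d + j) ≡ (a , c)) (ℕₚ.+-identityʳ d) refl
                                      (unpair-+ d (trans eq (cong (0 ,_) (sym (ℕₚ.+-identityʳ d))))))

unpair-surjective : ∀ a c → ∃[ j ] unpair j ≡ (a , c)
unpair-surjective a c with unpair-antidiagonal (a + c)
... | j , eq = a + j , subst (λ a′ → unpair (a + j) ≡ (a′ , c)) (ℕₚ.+-identityʳ a) (unpair-+ a eq)

decode : ℕ → ℕ → ℕ
decode x zero    = proj₁ (unpair x)
decode x (suc i) = decode (proj₂ (unpair x)) i

decode-surjective : ∀ (v : ℕ → ℕ) L → ∃[ x ] (∀ i → i < L → decode x i ≡ v i)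
decode-surjective v zero    = 0 , λ _ ()
decode-surjective v (suc L) with decode-surjective (v ∘ suc) L
... | x′ , x′-codes with unpair-surjective (v 0) x′
... | x , unpair-x = x , λ where
  zero    _         → cong proj₁ unpair-x
  (suc i) (s≤s i<L) → trans (cong (λ y → decode (proj₂ y) i) unpair-x) (x′-codes i i<L)

-- Digit sequences generated by linear recurrences modulo b

module LinearRecurrence (b : ℕ) .{{_ : NonZero b}} (p q : ℕ) (c u₀ : ℕ → ℕ) where

  next-term : ℕ → (ℕ → ℕ) → ℕ
  next-term n earlier with n ℕ.<? q + p
  ... | yes _ = u₀ n
  ... | no  _ = sumℤ p (λ i → + c i ℤ.* + earlier (n ∸ p + i)) %ℕ b

  -- history L k is the k-th term when k < L, and junk otherwise.
  history : ℕ → ℕ → ℕ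
  history zero    k = 0
  history (suc L) k with k ℕ.<? L
  ... | yes _ = history L k
  ... | no  _ = next-term L (history L)

  term : ℕ → ℕ
  term n = history (suc n) n

  module _ (s : ℕ → Fin b) (c′ : ℕ → ℤ)
           (recurrence : ∀ n → q ≤ n →
              digitsℤ s (n + p) ≡ sumℤ p (λ i → c′ i ℤ.* digitsℤ s (n + i)) [mod b ])
           (c≡c′ : ∀ i → i < p → c i ≡ c′ i %ℕ b)
           (u₀≡s : ∀ n → n < q + p → u₀ n ≡ toℕ (s n)) where

    recurrence-reduced : ∀ {n} → q + p ≤ n →
      + toℕ (s n) ≡ sumℤ p (λ i → + c i ℤ.* + toℕ (s (n ∸ p + i))) ⟨mod b ⟩
    recurrence-reduced {n} q+p≤n = mod-trans s≡Σc′d (mod-sumℤ p c′d≡cd)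
      where
      d : ℕ → ℤ
      d i = digitsℤ s (n ∸ p + i)
      p≤n : p ≤ n
      p≤n = ℕₚ.≤-trans (ℕₚ.m≤n+m p q) q+p≤n
      q≤n∸p : q ≤ n ∸ p
      q≤n∸p = subst (_≤ n ∸ p) (ℕₚ.m+n∸n≡m q p) (ℕₚ.∸-monoˡ-≤ p q+p≤n)
      s≡Σc′d : digitsℤ s n ≡ sumℤ p (λ i → c′ i ℤ.* d i) ⟨mod b ⟩
      s≡Σc′d = subst (λ m → digitsℤ s m ≡ sumℤ p (λ i → c′ i ℤ.* d i) ⟨mod b ⟩) (ℕₚ.m∸n+n≡m p≤n)
                 ([mod]⇒⟨mod⟩ (recurrence (n ∸ p) q≤n∸p))
      c′d≡cd : ∀ i → i < p → c′ i ℤ.* d i ≡ + c i ℤ.* d i ⟨mod b ⟩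
      c′d≡cd i i<p rewrite c≡c′ i i<p = mod-*ʳ (d i) (mod-%ℕ (c′ i))

    next-term-correct : ∀ n {earlier} → (∀ k → k < n → earlier k ≡ toℕ (s k)) →
                        next-term n earlier ≡ toℕ (s n)
    next-term-correct n {earlier} earlier≡s with n ℕ.<? q + p
    ... | yes n<q+p = u₀≡s n n<q+p
    ... | no  n≮q+p =
      sym (mod-residue-unique (Finₚ.toℕ<n (s n)) (n%ℕd<d T b) (mod-trans s≡T (mod-%ℕ T)))
      where
      q+p≤n : q + p ≤ n
      q+p≤n = ℕₚ.≮⇒≥ n≮q+p
      T : ℤ
      T = sumℤ p (λ i → + c i ℤ.* + earlier (n ∸ p + i))
      earlier<n : ∀ {i} → i < p → n ∸ p + i < n
      earlier<n {i} i<p = subst (n ∸ p + i <_) (ℕₚ.m∸n+n≡m (ℕₚ.≤-trans (ℕₚ.m≤n+m p q) q+p≤n))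
                            (ℕₚ.+-monoʳ-< (n ∸ p) i<p)
      s≡T : + toℕ (s n) ≡ T ⟨mod b ⟩
      s≡T = subst (+ toℕ (s n) ≡_⟨mod b ⟩)
              (sumℤ-cong p λ i i<p → cong (λ v → + c i ℤ.* + v) (sym (earlier≡s _ (earlier<n i<p))))
              (recurrence-reduced q+p≤n)

    history-correct : ∀ L k → k < L → history L k ≡ toℕ (s k)
    history-correct (suc L) k k<1+L with k ℕ.<? L
    ... | yes k<L = history-correct L k k<L
    ... | no  k≮L rewrite ℕₚ.≤-antisym (ℕₚ.≤-pred k<1+L) (ℕₚ.≮⇒≥ k≮L) =
      next-term-correct L (history-correct L)

    term-correct : ∀ n → term n ≡ toℕ (s n)
    term-correct n = history-correct (suc n) n ℕₚ.≤-refl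

record RecurrenceCode : Set where
  constructor recurrenceCode
  field order offset coefficients initialValues : ℕ

recurrenceDigits : (b : ℕ) .{{_ : NonZero b}} → RecurrenceCode → ℕ → Fin b
recurrenceDigits b (recurrenceCode p q cs us) n =
  LinearRecurrence.term b p q (decode cs) (decode us) n mod b

decodeRecurrence : ℕ → RecurrenceCode
decodeRecurrence j =
  let i , k = unpair j; p , q = unpair i; cs , us = unpair k in recurrenceCode p q cs us

decodeRecurrence-surjective : ∀ R → ∃[ j ] decodeRecurrence j ≡ R
decodeRecurrence-surjective (recurrenceCode p q cs us)
  with unpair-surjective p q | unpair-surjective cs us
... | i , unpair-i | k , unpair-k with unpair-surjective i k
... | j , unpair-j = j , decode-j
  where
  decode-j : decodeRecurrence j ≡ recurrenceCode p q cs us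
  decode-j rewrite unpair-j | unpair-i | unpair-k = refl

toℕ-mod : ∀ {b} .{{_ : NonZero b}} (x : Fin b) → toℕ x mod b ≡ x
toℕ-mod {b} x = Finₚ.toℕ-injective (trans (Finₚ.toℕ-fromℕ< _) (m<n⇒m%n≡m (Finₚ.toℕ<n x)))

MCFinite⇒recurrenceDigits : ∀ b .{{_ : NonZero b}} (s : ℕ → Fin b) → MCFinite (digitsℤ s) →
                            ∃[ R ] s ≗ recurrenceDigits b R
MCFinite⇒recurrenceDigits b s mc with mc b (ℕ.>-nonZero⁻¹ b)
... | p , q , c′ , _ , _ , recurrence
    with decode-surjective (λ i → c′ i %ℕ b) p | decode-surjective (toℕ ∘ s) (q + p)
... | cs , cs-codes | us , us-codes = recurrenceCode p q cs us , λ n →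
  sym (trans (cong (_mod b) (term-correct s c′ recurrence cs-codes us-codes n)) (toℕ-mod (s n)))
  where open LinearRecurrence b p q (decode cs) (decode us)

MCFinite-digits-null : (b : ℕ) (hb : 2 ≤ b) → LebesgueNull b hb (λ s → MCFinite (digitsℤ s))
MCFinite-digits-null b hb = countable⇒LebesgueNull b hb (recurrenceDigits b ∘ decodeRecurrence) λ s mc →
  let R , s≗R = MCFinite⇒recurrenceDigits b s mc
      j , j↦R = decodeRecurrence-surjective R
  in j , subst (λ R′ → s ≗ recurrenceDigits b R′) (sym j↦R) s≗R
  where instance _ = ℕ.>-nonZero (ℕₚ.≤-trans (s≤s z≤n) hb)

monotone-MCFinite-uncountable : UncountablyMany (λ s → MonotoneIncreasing s × MCFinite s)
monotone-MCFinite-uncountable =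
  factorialSums , (λ α → factorialSums-monotone α , factorialSums-MCFinite α) , factorialSums-injective

monotone-¬MCFinite-uncountable : UncountablyMany (λ s → MonotoneIncreasing s × ¬ MCFinite s)
monotone-¬MCFinite-uncountable =
  oddAtPowersOf2 , (λ α → oddAtPowersOf2-monotone α , oddAtPowersOf2-¬MCFinite α) , oddAtPowersOf2-injective

proposition6 :
    (UncountablyMany (λ s → MonotoneIncreasing s × MCFinite s)
      × UncountablyMany (λ s → MonotoneIncreasing s × ¬ MCFinite s))
    × ((b : ℕ) → (hb : 2 ≤ b) →
        LebesgueNull b hb (λ (s : ℕ → Fin b) → MCFinite (digitsℤ s)))
proposition6 = (monotone-MCFinite-uncountable , monotone-¬MCFinite-uncountable) , MCFinite-digits-null
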